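{- For $n\ge1$ let $A_n$ be the set of integer sequences $e=(e_1,\dots,e_n)$ with $0\le e_i<i$ for which there are no indices $i<j<k$ with $e_j<e_k$ and $e_i\ge e_k$. For $e\in A_n$, call $c\in\{0,1,\dots,n\}$ an active site if $(e_1,\dots,e_n,c)\in A_{n+1}$; let $h(e)$ be the number of active sites $c\le \max(e_1,\dots,e_n)$ and $k(e)$ the number of active sites $c>\max(e_1,\dots,e_n)$, and give $e$ the label $(h(e),k(e))$. Then the sequence $(0)\in A_1$ has label $(1,1)$, and for every $e\in A_n$ with label $(h,k)$, the multiset of labels of the sequences $(e_1,\dots,e_n,c)$ for $c$ ranging over the active sites of $e$ is $\{(1,k+1),(2,k+1),\dots,(h,k+1),(h+k,1),(h+k-1,2),\dots,(h+1,k)\}$. Consequently $|A_n|$ equals the $n$-th semi-Baxter number.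
   Context: The semi-Baxter numbers $SB_n$ are the numbers of permutations of $[n]$ avoiding the vincular pattern $2\underline{41}3$ (i.e. with no $a<b<b+1<c$ with $\pi_{b+1}<\pi_a<\pi_c<\pi_b$); equivalently they are the numbers of nodes at level $n$ of the generating tree with root label $(1,1)$ and succession rule $(h,k)\rightsquigarrow (1,k+1),\dots,(h,k+1),(h+k,1),\dots,(h+1,k)$. -}

module Defs where

open import Data.Nat using (ℕ; zero; suc; _+_; _∸_; _≤_; _<_; _⊔_)
open import Data.Nat.Properties using (_≤?_; _<?_)
open import Data.Fin using (Fin; toℕ)
import Data.Fin as F
import Data.Fin.Properties as FP
open import Data.Vec using (Vec; []; _∷_; lookup; _∷ʳ_; foldr′)
open import Data.List using (List; []; _∷_; map; filter; length; upTo; concatMap; _++_)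
open import Data.Product using (_×_; _,_)
open import Relation.Nullary using (¬_; Dec)
open import Relation.Nullary.Decidable using (_×-dec_; _→-dec_; ¬?)

-- Sequences e = (e_1,…,e_n) are vectors; position i (1-based) is Fin index i-1.
-- Inversion sequence: 0 ≤ e_i < i  (0-based: lookup e i < suc (toℕ i)).
InvSeq : ∀ {n} → Vec ℕ n → Set
InvSeq {n} e = (i : Fin n) → lookup e i < suc (toℕ i)

Avoids : ∀ {n} → Vec ℕ n → Set
Avoids {n} e = (i j k : Fin n) → i F.< j → j F.< k →
  ¬ (lookup e j < lookup e k × lookup e k ≤ lookup e i)

InA : ∀ {n} → Vec ℕ n → Set
InA e = InvSeq e × Avoids e

InA? : ∀ {n} (e : Vec ℕ n) → Dec (InA e)
InA? e = FP.all? (λ i → lookup e i <? suc (toℕ i))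
  ×-dec FP.all? (λ i → FP.all? (λ j → FP.all? (λ k →
          (i FP.<? j) →-dec ((j FP.<? k) →-dec
            ¬? ((lookup e j <? lookup e k) ×-dec (lookup e k ≤? lookup e i))))))

activeSites : ∀ {n} → Vec ℕ n → List ℕ
activeSites {n} e = filter (λ c → InA? (e ∷ʳ c)) (upTo (suc n))

maxSeq : ∀ {n} → Vec ℕ n → ℕ
maxSeq = foldr′ _⊔_ 0

label : ∀ {n} → Vec ℕ n → ℕ × ℕ
label e = length (filter (λ c → c ≤? maxSeq e) (activeSites e))
        , length (filter (λ c → maxSeq e <? c) (activeSites e))

rule : ℕ × ℕ → List (ℕ × ℕ)
rule (h , k) = map (λ i → (suc i , suc k)) (upTo h)
            ++ map (λ j → (h + (k ∸ j) , suc j)) (upTo k)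

-- Labels at level (n+1) of the generating tree with root (1,1) at level 1.
treeLevel : ℕ → List (ℕ × ℕ)
treeLevel zero = (1 , 1) ∷ []
treeLevel (suc n) = concatMap rule (treeLevel n)

-- Semi-Baxter numbers: SB_n = number of nodes at level n (SB_0 = 1 by convention).
SB : ℕ → ℕ
SB zero = 1
SB (suc n) = length (treeLevel n)

-- Call x blocked in e if e_j < x ≤ e_i for some i < j. Appending c to e ∈ A_n stays in A_{n+1}
-- exactly when c ≤ n and c is not blocked, and blocked values never exceed m = max e. So the
-- active sites of e are the h unblocked values in [0, m] followed by the k = n − m values above m.
-- Appending an active c ≤ m keeps the maximum and blocks exactly the values in (c, m], so the
-- child's label is (rank of c among the unblocked values, k + 1); appending c = m + 1 + t blocks
-- nothing new and raises the maximum to c, so the label is (h + t + 1, k − t). Hence the children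
-- of e carry the labels of rule (h , k), and since every sequence of A_{n+1} is the child of exactly
-- one sequence of A_n, the labels of A_{n+1} form the next level of the generating tree.

module Submission where

open import Defs
open import Data.Nat using (ℕ; zero; suc; _+_; _∸_; _≤_; _<_; _⊔_; z≤n; s≤s; s≤s⁻¹)
open import Data.Nat.Properties
open import Data.Fin using (Fin; toℕ; fromℕ; inject₁) renaming (zero to fzero; suc to fsuc)
import Data.Fin as F
open import Data.Fin.Properties using (toℕ-inject₁; toℕ-fromℕ; toℕ<n; inject₁ℕ<; ≤fromℕ; any?) renaming (_<?_ to _<ᶠ?_)
open import Data.Fin.Relation.Unary.Top using (view; ‵fromℕ; ‵inject₁)
open import Data.Vec using (Vec; []; _∷_; _∷ʳ_; lookup; initLast)
open import Data.Vec.Properties using (∷ʳ-injectiveˡ; ∷ʳ-injectiveʳ)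
open import Data.List using (List; []; _∷_; [_]; _++_; map; filter; length; upTo; applyUpTo; applyDownFrom; reverse; concatMap)
open import Data.List.Properties
  using (filter-++; filter-all; filter-none; filter-accept; filter-reject; map-++; map-∘; map-cong-local;
         length-++; length-map; length-upTo; upTo-∷ʳ; map-upTo; reverse-applyUpTo; ++-identityʳ;
         map-concatMap; concatMap-map)
open import Data.List.Relation.Unary.All as All using (All; []; _∷_)
open import Data.List.Relation.Unary.All.Properties using (applyUpTo⁺₁) renaming (map⁺ to All-map⁺)
open import Data.List.Relation.Unary.Any using (here; there)
import Data.List.Relation.Unary.AllPairs as AllPairs
import Data.List.Relation.Unary.AllPairs.Properties as AllPairs
open import Data.List.Relation.Binary.Disjoint.Propositional using (Disjoint)
open import Data.List.Relation.Unary.Unique.Propositional using (Unique)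
import Data.List.Relation.Unary.Unique.Propositional.Properties as Unique
open import Data.List.Membership.Propositional using (_∈_; find; lose)
open import Data.List.Membership.Propositional.Properties
  using (∈-upTo⁺; ∈-upTo⁻; ∈-filter⁺; ∈-filter⁻; ∈-map⁺; ∈-map⁻; ∈-concatMap⁺; ∈-concatMap⁻)
open import Data.List.Relation.Binary.Permutation.Propositional
  using (_↭_; ↭-refl; ↭-trans; ↭-reflexive; prep; swap; module PermutationReasoning)
import Data.List.Relation.Binary.Permutation.Propositional as ↭
import Data.List.Relation.Binary.Permutation.Propositional.Properties as Perm
open import Data.Product using (_×_; _,_; proj₁; proj₂; ∃; ∃₂)
open import Data.Sum using (_⊎_; inj₁; inj₂; [_,_]′)
open import Data.Unit using (tt)
open import Function using (_∘_; id)
open import Function.Bundles using (_⇔_; mk⇔; Equivalence)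
open import Relation.Nullary using (¬_; Dec; yes; no; contradiction)
open import Relation.Nullary.Decidable using (_×-dec_; toWitness)
open import Relation.Unary using (Decidable; ∁)
open import Relation.Unary.Properties using (∁?)
open import Relation.Binary.PropositionalEquality
  using (_≡_; _≢_; refl; sym; trans; cong; cong₂; subst; module ≡-Reasoning)

open Equivalence using (to; from)

private
  variable
    A B : Set
    n : ℕ

-- Lists and permutations

filter-cong-local : ∀ {P Q : A → Set} (P? : Decidable P) (Q? : Decidable Q) {xs : List A} →
                    (∀ {x} → x ∈ xs → P x ⇔ Q x) → filter P? xs ≡ filter Q? xs
filter-cong-local P? Q? {[]} _ = refl
filter-cong-local P? Q? {x ∷ xs} P⇔Q with P? x | Q? x
... | yes _  | yes _  = cong (x ∷_) (filter-cong-local P? Q? (P⇔Q ∘ there))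
... | no _   | no _   = filter-cong-local P? Q? (P⇔Q ∘ there)
... | yes px | no ¬qx = contradiction (to (P⇔Q (here refl)) px) ¬qx
... | no ¬px | yes qx = contradiction (from (P⇔Q (here refl)) qx) ¬px

applyUpTo-+ : ∀ (f : ℕ → A) m n → applyUpTo f (m + n) ≡ applyUpTo f m ++ applyUpTo (f ∘ (m +_)) n
applyUpTo-+ f zero    n = refl
applyUpTo-+ f (suc m) n = cong (f 0 ∷_) (applyUpTo-+ (f ∘ suc) m n)

upTo-+ : ∀ m n → upTo (m + n) ≡ upTo m ++ map (m +_) (upTo n)
upTo-+ m n = trans (applyUpTo-+ id m n) (cong (upTo m ++_) (sym (map-upTo (m +_) n)))

upTo-split : ∀ {m n} → m ≤ n → upTo n ≡ upTo m ++ map (m +_) (upTo (n ∸ m))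
upTo-split {m} {n} m≤n = trans (cong upTo (sym (m+[n∸m]≡n m≤n))) (upTo-+ m (n ∸ m))

<∸⇒+< : ∀ {m n t} → m ≤ n → t < n ∸ m → m + t < n
<∸⇒+< {m} {n} {t} m≤n t< = subst (m + t <_) (m+[n∸m]≡n m≤n) (+-monoʳ-< m t<)

length-map-upTo : ∀ (f : ℕ → A) n → length (map f (upTo n)) ≡ n
length-map-upTo f n = trans (length-map f (upTo n)) (length-upTo n)

All-upTo : ∀ {P : ℕ → Set} {n} → (∀ {x} → x < n → P x) → All P (upTo n)
All-upTo {n = n} = applyUpTo⁺₁ id n

All-filter-upTo : ∀ {P Q : ℕ → Set} (P? : Decidable P) {n} →
                  (∀ {x} → x < n → P x → Q x) → All Q (filter P? (upTo n))
All-filter-upTo P? f = All.tabulate λ x∈ → let x∈upTo , px = ∈-filter⁻ P? x∈ in f (∈-upTo⁻ x∈upTo) px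

filter-++-accept-reject : ∀ {P : A → Set} (P? : Decidable P) {xs ys} → All P xs → All (∁ P) ys →
                          filter P? (xs ++ ys) ≡ xs
filter-++-accept-reject P? {xs} {ys} pxs ¬pys = begin
  filter P? (xs ++ ys)             ≡⟨ filter-++ P? xs ys ⟩
  filter P? xs ++ filter P? ys     ≡⟨ cong₂ _++_ (filter-all P? pxs) (filter-none P? ¬pys) ⟩
  xs ++ []                         ≡⟨ ++-identityʳ xs ⟩
  xs                               ∎
  where open ≡-Reasoning

filter-++-reject-accept : ∀ {P : A → Set} (P? : Decidable P) {xs ys} → All (∁ P) xs → All P ys →
                          filter P? (xs ++ ys) ≡ ys
filter-++-reject-accept P? {xs} {ys} ¬pxs pys = begin
  filter P? (xs ++ ys)             ≡⟨ filter-++ P? xs ys ⟩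
  filter P? xs ++ filter P? ys     ≡⟨ cong₂ _++_ (filter-none P? ¬pxs) (filter-all P? pys) ⟩
  ys                               ∎
  where open ≡-Reasoning

module _ {P : ℕ → Set} (P? : Decidable P) where

  filter-upTo-suc : ∀ n → filter P? (upTo (suc n)) ≡ filter P? (upTo n) ++ filter P? [ n ]
  filter-upTo-suc n = trans (cong (filter P?) (sym (upTo-∷ʳ n))) (filter-++ P? (upTo n) [ n ])

  filter-upTo-suc-accept : ∀ {n} → P n → filter P? (upTo (suc n)) ≡ filter P? (upTo n) ++ [ n ]
  filter-upTo-suc-accept {n} pn =
    trans (filter-upTo-suc n) (cong (filter P? (upTo n) ++_) (filter-accept P? pn))

  filter-upTo-suc-reject : ∀ {n} → ¬ P n → filter P? (upTo (suc n)) ≡ filter P? (upTo n)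
  filter-upTo-suc-reject {n} ¬pn =
    trans (filter-upTo-suc n) (trans (cong (filter P? (upTo n) ++_) (filter-reject P? ¬pn)) (++-identityʳ _))

  map-rank-filter-upTo : ∀ n → map (λ x → length (filter P? (upTo (suc x)))) (filter P? (upTo n))
                             ≡ map suc (upTo (length (filter P? (upTo n))))
  map-rank-filter-upTo zero = refl
  map-rank-filter-upTo (suc n) with P? n
  ... | no ¬pn rewrite filter-upTo-suc-reject ¬pn = map-rank-filter-upTo n
  ... | yes pn = begin
    map rank (filter P? (upTo (suc n)))         ≡⟨ cong (map rank) (filter-upTo-suc-accept pn) ⟩
    map rank (filter P? (upTo n) ++ [ n ])      ≡⟨ map-++ rank (filter P? (upTo n)) [ n ] ⟩
    map rank (filter P? (upTo n)) ++ [ rank n ] ≡⟨ cong₂ (λ xs x → xs ++ [ x ]) (map-rank-filter-upTo n) rank-n ⟩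
    map suc (upTo r) ++ [ suc r ]               ≡⟨ map-++ suc (upTo r) [ r ] ⟨
    map suc (upTo r ++ [ r ])                   ≡⟨ cong (map suc) (upTo-∷ʳ r) ⟩
    map suc (upTo (suc r))                      ≡⟨ cong (map suc ∘ upTo) rank-n ⟨
    map suc (upTo (rank n))                     ∎
    where
      open ≡-Reasoning
      rank : ℕ → ℕ
      rank x = length (filter P? (upTo (suc x)))
      r : ℕ
      r = length (filter P? (upTo n))
      rank-n : rank n ≡ suc r
      rank-n = trans (cong length (filter-upTo-suc-accept pn))
                     (trans (length-++ (filter P? (upTo n))) (+-comm r 1))

applyDownFrom-applyUpTo : ∀ (f : ℕ → A) n → applyDownFrom f n ≡ applyUpTo (λ t → f (n ∸ suc t)) n
applyDownFrom-applyUpTo f zero    = refl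
applyDownFrom-applyUpTo f (suc n) = cong (f n ∷_) (applyDownFrom-applyUpTo f n)

map-upTo-reverse-↭ : ∀ (f : ℕ → A) n → map (λ t → f (n ∸ suc t)) (upTo n) ↭ map f (upTo n)
map-upTo-reverse-↭ f n = begin
  map (λ t → f (n ∸ suc t)) (upTo n)   ≡⟨ map-upTo _ n ⟩
  applyUpTo (λ t → f (n ∸ suc t)) n    ≡⟨ sym (applyDownFrom-applyUpTo f n) ⟩
  applyDownFrom f n                    ≡⟨ sym (reverse-applyUpTo f n) ⟩
  reverse (applyUpTo f n)              ↭⟨ Perm.↭-reverse (applyUpTo f n) ⟩
  applyUpTo f n                        ≡⟨ sym (map-upTo f n) ⟩
  map f (upTo n)                       ∎
  where open PermutationReasoning

concatMap⁺ : ∀ (f : A → List B) {xs ys} → xs ↭ ys → concatMap f xs ↭ concatMap f ys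
concatMap⁺ f ↭.refl         = ↭-refl
concatMap⁺ f (prep x p)     = Perm.++⁺ˡ (f x) (concatMap⁺ f p)
concatMap⁺ f (swap x y p)   = ↭-trans (Perm.shifts (f x) (f y))
                                      (Perm.++⁺ˡ (f y) (Perm.++⁺ˡ (f x) (concatMap⁺ f p)))
concatMap⁺ f (↭.trans p q) = ↭-trans (concatMap⁺ f p) (concatMap⁺ f q)

concatMap-cong-↭ : ∀ {f g : A → List B} (xs : List A) → (∀ {x} → x ∈ xs → f x ↭ g x) →
                   concatMap f xs ↭ concatMap g xs
concatMap-cong-↭ []       _   = ↭-refl
concatMap-cong-↭ (x ∷ xs) f↭g = Perm.++⁺ (f↭g (here refl)) (concatMap-cong-↭ xs (f↭g ∘ there))

concatMap-unique : ∀ (f : A → List B) {xs} → Unique xs → (∀ x → Unique (f x)) →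
                   (∀ {x y} → x ≢ y → Disjoint (f x) (f y)) → Unique (concatMap f xs)
concatMap-unique f xs! f! disjoint =
  Unique.concat⁺ (All-map⁺ (All.universal f! _)) (AllPairs.map⁺ (AllPairs.map disjoint xs!))

-- Snoc and maximum of vectors

lookup-∷ʳ-inject₁ : ∀ (e : Vec A n) c i → lookup (e ∷ʳ c) (inject₁ i) ≡ lookup e i
lookup-∷ʳ-inject₁ (x ∷ e) c fzero    = refl
lookup-∷ʳ-inject₁ (x ∷ e) c (fsuc i) = lookup-∷ʳ-inject₁ e c i

lookup-∷ʳ-fromℕ : ∀ (e : Vec A n) c → lookup (e ∷ʳ c) (fromℕ n) ≡ c
lookup-∷ʳ-fromℕ []      c = refl
lookup-∷ʳ-fromℕ (x ∷ e) c = lookup-∷ʳ-fromℕ e c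

inject₁-mono-< : {i j : Fin n} → i F.< j → inject₁ i F.< inject₁ j
inject₁-mono-< {i = i} {j} rewrite toℕ-inject₁ i | toℕ-inject₁ j = id

inject₁-cancel-< : {i j : Fin n} → inject₁ i F.< inject₁ j → i F.< j
inject₁-cancel-< {i = i} {j} rewrite toℕ-inject₁ i | toℕ-inject₁ j = id

inject₁<fromℕ : (i : Fin n) → inject₁ i F.< fromℕ n
inject₁<fromℕ {n} i rewrite toℕ-fromℕ n = inject₁ℕ< i

fromℕ≮ : (i : Fin (suc n)) → ¬ (fromℕ n F.< i)
fromℕ≮ i fromℕ<i = <⇒≱ fromℕ<i (≤fromℕ i)

lookup≤maxSeq : ∀ (e : Vec ℕ n) i → lookup e i ≤ maxSeq e
lookup≤maxSeq (x ∷ e) fzero    = m≤m⊔n x (maxSeq e)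
lookup≤maxSeq (x ∷ e) (fsuc i) = ≤-trans (lookup≤maxSeq e i) (m≤n⊔m x (maxSeq e))

maxSeq-lub : ∀ (e : Vec ℕ n) {b} → (∀ i → lookup e i ≤ b) → maxSeq e ≤ b
maxSeq-lub []      _    = z≤n
maxSeq-lub (x ∷ e) e≤b = ⊔-lub (e≤b fzero) (maxSeq-lub e (e≤b ∘ fsuc))

≤maxSeq⇒≤lookup : ∀ (e : Vec ℕ n) {x} → 0 < x → x ≤ maxSeq e → ∃ λ i → x ≤ lookup e i
≤maxSeq⇒≤lookup []      0<x x≤0 = contradiction x≤0 (<⇒≱ 0<x)
≤maxSeq⇒≤lookup (y ∷ e) 0<x x≤max with ⊔-sel y (maxSeq e)
... | inj₁ max≡y = fzero , subst (_ ≤_) max≡y x≤max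
... | inj₂ max≡m = let i , x≤eᵢ = ≤maxSeq⇒≤lookup e 0<x (subst (_ ≤_) max≡m x≤max) in fsuc i , x≤eᵢ

maxSeq-∷ʳ : ∀ (e : Vec ℕ n) c → maxSeq (e ∷ʳ c) ≡ maxSeq e ⊔ c
maxSeq-∷ʳ []      c = ⊔-identityʳ c
maxSeq-∷ʳ (x ∷ e) c = trans (cong (x ⊔_) (maxSeq-∷ʳ e c)) (sym (⊔-assoc x (maxSeq e) c))

InvSeq⇒maxSeq≤ : ∀ (e : Vec ℕ n) → InvSeq e → maxSeq e ≤ n
InvSeq⇒maxSeq≤ e inv = maxSeq-lub e λ i → ≤-trans (s≤s⁻¹ (inv i)) (<⇒≤ (toℕ<n i))

-- Blocked values

Between : ℕ → ℕ → ℕ → Set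
Between lo hi x = lo < x × x ≤ hi

Between? : ∀ lo hi x → Dec (Between lo hi x)
Between? lo hi x = (lo <? x) ×-dec (x ≤? hi)

Between-cong : ∀ {lo lo′ hi hi′ x x′} → lo ≡ lo′ → hi ≡ hi′ → x ≡ x′ →
               Between lo hi x → Between lo′ hi′ x′
Between-cong refl refl refl b = b

Blocked : Vec ℕ n → ℕ → Set
Blocked {n} e x = ∃₂ λ (i j : Fin n) → i F.< j × Between (lookup e j) (lookup e i) x

Blocked? : (e : Vec ℕ n) → Decidable (Blocked e)
Blocked? e x = any? λ i → any? λ j → (i <ᶠ? j) ×-dec Between? (lookup e j) (lookup e i) x

Blocked⇒≤maxSeq : ∀ (e : Vec ℕ n) {x} → Blocked e x → x ≤ maxSeq e
Blocked⇒≤maxSeq e (i , _ , _ , _ , x≤eᵢ) = ≤-trans x≤eᵢ (lookup≤maxSeq e i)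

InvSeq-∷ʳ⁻ : ∀ (e : Vec ℕ n) c → InvSeq (e ∷ʳ c) → InvSeq e × c < suc n
InvSeq-∷ʳ⁻ {n} e c inv = invₑ , c<
  where
    invₑ : InvSeq e
    invₑ i with inv (inject₁ i)
    ... | bound rewrite lookup-∷ʳ-inject₁ e c i | toℕ-inject₁ i = bound
    c< : c < suc n
    c< with inv (fromℕ n)
    ... | bound rewrite lookup-∷ʳ-fromℕ e c | toℕ-fromℕ n = bound

InvSeq-∷ʳ⁺ : ∀ (e : Vec ℕ n) c → InvSeq e → c < suc n → InvSeq (e ∷ʳ c)
InvSeq-∷ʳ⁺ {n} e c inv c< k with view k
... | ‵fromℕ     rewrite lookup-∷ʳ-fromℕ e c | toℕ-fromℕ n = c<
... | ‵inject₁ i rewrite lookup-∷ʳ-inject₁ e c i | toℕ-inject₁ i = inv i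

Avoids-∷ʳ⁻ : ∀ (e : Vec ℕ n) c → Avoids (e ∷ʳ c) → Avoids e × ¬ Blocked e c
Avoids-∷ʳ⁻ {n} e c av = avoidsₑ , unblocked
  where
    lookup-inj : ∀ i → lookup (e ∷ʳ c) (inject₁ i) ≡ lookup e i
    lookup-inj = lookup-∷ʳ-inject₁ e c
    avoidsₑ : Avoids e
    avoidsₑ i j k i<j j<k b =
      av (inject₁ i) (inject₁ j) (inject₁ k) (inject₁-mono-< i<j) (inject₁-mono-< j<k)
         (Between-cong (sym (lookup-inj j)) (sym (lookup-inj i)) (sym (lookup-inj k)) b)
    unblocked : ¬ Blocked e c
    unblocked (i , j , i<j , b) =
      av (inject₁ i) (inject₁ j) (fromℕ n) (inject₁-mono-< i<j) (inject₁<fromℕ j)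
         (Between-cong (sym (lookup-inj j)) (sym (lookup-inj i)) (sym (lookup-∷ʳ-fromℕ e c)) b)

Avoids-∷ʳ⁺ : ∀ (e : Vec ℕ n) c → Avoids e → ¬ Blocked e c → Avoids (e ∷ʳ c)
Avoids-∷ʳ⁺ {n} e c av unblocked i j k i<j j<k with view k | view j | view i
... | _           | ‵fromℕ      | _           = contradiction j<k (fromℕ≮ k)
... | _           | ‵inject₁ _  | ‵fromℕ      = contradiction i<j (fromℕ≮ j)
... | ‵fromℕ      | ‵inject₁ j′ | ‵inject₁ i′ = λ b →
  unblocked (i′ , j′ , inject₁-cancel-< i<j ,
             Between-cong (lookup-∷ʳ-inject₁ e c j′) (lookup-∷ʳ-inject₁ e c i′) (lookup-∷ʳ-fromℕ e c) b)
... | ‵inject₁ k′ | ‵inject₁ j′ | ‵inject₁ i′ = λ b →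
  av i′ j′ k′ (inject₁-cancel-< i<j) (inject₁-cancel-< j<k)
     (Between-cong (lookup-∷ʳ-inject₁ e c j′) (lookup-∷ʳ-inject₁ e c i′) (lookup-∷ʳ-inject₁ e c k′) b)

InA-∷ʳ⁻ : ∀ (e : Vec ℕ n) c → InA (e ∷ʳ c) → InA e × c < suc n × ¬ Blocked e c
InA-∷ʳ⁻ e c (inv , av) = let invₑ , c< = InvSeq-∷ʳ⁻ e c inv; avₑ , unblocked = Avoids-∷ʳ⁻ e c av
                          in (invₑ , avₑ) , c< , unblocked

InA-∷ʳ⁺ : ∀ (e : Vec ℕ n) c → InA e → c < suc n → ¬ Blocked e c → InA (e ∷ʳ c)
InA-∷ʳ⁺ e c (inv , av) c< unblocked = InvSeq-∷ʳ⁺ e c inv c< , Avoids-∷ʳ⁺ e c av unblocked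

Blocked-∷ʳ⁻ : ∀ (e : Vec ℕ n) c {x} → Blocked (e ∷ʳ c) x → Blocked e x ⊎ Between c (maxSeq e) x
Blocked-∷ʳ⁻ {n} e c (i , j , i<j , b) with view j | view i
... | ‵fromℕ     | ‵fromℕ      = contradiction i<j (<-irrefl refl)
... | ‵inject₁ _ | ‵fromℕ      = contradiction i<j (fromℕ≮ j)
... | ‵fromℕ     | ‵inject₁ i′ =
  let c<x , x≤eᵢ = Between-cong (lookup-∷ʳ-fromℕ e c) (lookup-∷ʳ-inject₁ e c i′) refl b
  in inj₂ (c<x , ≤-trans x≤eᵢ (lookup≤maxSeq e i′))
... | ‵inject₁ j′ | ‵inject₁ i′ =
  inj₁ (i′ , j′ , inject₁-cancel-< i<j ,
        Between-cong (lookup-∷ʳ-inject₁ e c j′) (lookup-∷ʳ-inject₁ e c i′) refl b)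

Blocked-∷ʳ⁺ : ∀ (e : Vec ℕ n) c {x} → Blocked e x ⊎ Between c (maxSeq e) x → Blocked (e ∷ʳ c) x
Blocked-∷ʳ⁺ {n} e c (inj₁ (i , j , i<j , b)) =
  inject₁ i , inject₁ j , inject₁-mono-< i<j ,
  Between-cong (sym (lookup-∷ʳ-inject₁ e c j)) (sym (lookup-∷ʳ-inject₁ e c i)) refl b
Blocked-∷ʳ⁺ {n} e c (inj₂ (c<x , x≤max)) =
  let i , x≤eᵢ = ≤maxSeq⇒≤lookup e (≤-trans (s≤s z≤n) c<x) x≤max
  in inject₁ i , fromℕ n , inject₁<fromℕ i ,
     Between-cong (sym (lookup-∷ʳ-fromℕ e c)) (sym (lookup-∷ʳ-inject₁ e c i)) refl (c<x , x≤eᵢ)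

unblocked-∷ʳ⇔ : ∀ (e : Vec ℕ n) c {x} → ¬ Between c (maxSeq e) x → (¬ Blocked (e ∷ʳ c) x) ⇔ (¬ Blocked e x)
unblocked-∷ʳ⇔ e c ¬new = mk⇔ (λ u′ b → u′ (Blocked-∷ʳ⁺ e c (inj₁ b)))
                             (λ u b′ → [ u , ¬new ]′ (Blocked-∷ʳ⁻ e c b′))

-- Labels

unblockedBelow : Vec ℕ n → ℕ → ℕ
unblockedBelow e x = length (filter (∁? (Blocked? e)) (upTo x))

maxSeq<⇒unblocked : ∀ (e : Vec ℕ n) {x} → maxSeq e < x → ¬ Blocked e x
maxSeq<⇒unblocked e m<x b = <⇒≱ m<x (Blocked⇒≤maxSeq e b)

activeSites-unblocked : ∀ (e : Vec ℕ n) → InA e → activeSites e ≡ filter (∁? (Blocked? e)) (upTo (suc n))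
activeSites-unblocked e ia = filter-cong-local (λ c → InA? (e ∷ʳ c)) (∁? (Blocked? e)) λ {c} c∈ →
  mk⇔ (λ ia′ → proj₂ (proj₂ (InA-∷ʳ⁻ e c ia′))) (InA-∷ʳ⁺ e c ia (∈-upTo⁻ c∈))

activeSites-split : ∀ (e : Vec ℕ n) → InA e →
  activeSites e ≡ filter (∁? (Blocked? e)) (upTo (suc (maxSeq e))) ++ map (suc (maxSeq e) +_) (upTo (n ∸ maxSeq e))
activeSites-split {n} e ia = begin
  activeSites e                                          ≡⟨ activeSites-unblocked e ia ⟩
  filter U? (upTo (suc n))                               ≡⟨ cong (filter U?) (upTo-split (s≤s m≤n)) ⟩
  filter U? (upTo (suc m) ++ above)                      ≡⟨ filter-++ U? (upTo (suc m)) above ⟩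
  filter U? (upTo (suc m)) ++ filter U? above            ≡⟨ cong (filter U? (upTo (suc m)) ++_) (filter-all U? all-unblocked) ⟩
  filter U? (upTo (suc m)) ++ above                      ∎
  where
    open ≡-Reasoning
    m : ℕ
    m = maxSeq e
    m≤n : m ≤ n
    m≤n = InvSeq⇒maxSeq≤ e (proj₁ ia)
    U? : Decidable (∁ (Blocked e))
    U? = ∁? (Blocked? e)
    above : List ℕ
    above = map (suc m +_) (upTo (n ∸ m))
    all-unblocked : All (∁ (Blocked e)) above
    all-unblocked = All-map⁺ (All-upTo λ {t} _ → maxSeq<⇒unblocked e (s≤s (m≤m+n m t)))

label-≡ : ∀ (e : Vec ℕ n) → InA e → label e ≡ (unblockedBelow e (suc (maxSeq e)) , n ∸ maxSeq e)
label-≡ {n} e ia = cong₂ _,_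
  (cong length (trans (cong (filter (_≤? m)) (activeSites-split e ia))
                      (filter-++-accept-reject (_≤? m) below≤m above≰m)))
  (trans (cong length (trans (cong (filter (m <?_)) (activeSites-split e ia))
                             (filter-++-reject-accept (m <?_) below≯m above>m)))
         (length-map-upTo (suc m +_) (n ∸ m)))
  where
    m : ℕ
    m = maxSeq e
    below≤m : All (_≤ m) (filter (∁? (Blocked? e)) (upTo (suc m)))
    below≤m = All-filter-upTo (∁? (Blocked? e)) λ x<sm _ → s≤s⁻¹ x<sm
    below≯m : All (∁ (m <_)) (filter (∁? (Blocked? e)) (upTo (suc m)))
    below≯m = All.map ≤⇒≯ below≤m
    above>m : All (m <_) (map (suc m +_) (upTo (n ∸ m)))
    above>m = All-map⁺ (All-upTo λ {t} _ → s≤s (m≤m+n m t))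
    above≰m : All (∁ (_≤ m)) (map (suc m +_) (upTo (n ∸ m)))
    above≰m = All.map <⇒≱ above>m

label-∷ʳ-≤maxSeq : ∀ (e : Vec ℕ n) {c} → InA e → ¬ Blocked e c → c ≤ maxSeq e →
                   label (e ∷ʳ c) ≡ (unblockedBelow e (suc c) , suc (n ∸ maxSeq e))
label-∷ʳ-≤maxSeq {n} e {c} ia unblocked c≤m = begin
  label (e ∷ʳ c)
    ≡⟨ label-≡ (e ∷ʳ c) (InA-∷ʳ⁺ e c ia (s≤s (≤-trans c≤m m≤n)) unblocked) ⟩
  (unblockedBelow (e ∷ʳ c) (suc (maxSeq (e ∷ʳ c))) , suc n ∸ maxSeq (e ∷ʳ c))
    ≡⟨ cong (λ m′ → unblockedBelow (e ∷ʳ c) (suc m′) , suc n ∸ m′) max-unchanged ⟩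
  (unblockedBelow (e ∷ʳ c) (suc m) , suc n ∸ m)
    ≡⟨ cong₂ _,_ (cong length unblocked-∷ʳ) (+-∸-assoc 1 m≤n) ⟩
  (unblockedBelow e (suc c) , suc (n ∸ m))
    ∎
  where
    open ≡-Reasoning
    m : ℕ
    m = maxSeq e
    m≤n : m ≤ n
    m≤n = InvSeq⇒maxSeq≤ e (proj₁ ia)
    U? : Decidable (∁ (Blocked e))
    U? = ∁? (Blocked? e)
    U′? : Decidable (∁ (Blocked (e ∷ʳ c)))
    U′? = ∁? (Blocked? (e ∷ʳ c))
    above : List ℕ
    above = map (suc c +_) (upTo (m ∸ c))
    max-unchanged : maxSeq (e ∷ʳ c) ≡ m
    max-unchanged = trans (maxSeq-∷ʳ e c) (m≥n⇒m⊔n≡m c≤m)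
    unchanged : filter U′? (upTo (suc c)) ≡ filter U? (upTo (suc c))
    unchanged = filter-cong-local U′? U? λ x∈ →
      unblocked-∷ʳ⇔ e c λ (c<x , _) → <⇒≱ c<x (s≤s⁻¹ (∈-upTo⁻ x∈))
    newly-blocked : All (∁ (∁ (Blocked (e ∷ʳ c)))) above
    newly-blocked = All-map⁺ (All-upTo λ {t} t< u′ →
      u′ (Blocked-∷ʳ⁺ e c (inj₂ (s≤s (m≤m+n c t) , s≤s⁻¹ (<∸⇒+< (s≤s c≤m) t<)))))
    unblocked-∷ʳ : filter U′? (upTo (suc m)) ≡ filter U? (upTo (suc c))
    unblocked-∷ʳ = begin
      filter U′? (upTo (suc m))                    ≡⟨ cong (filter U′?) (upTo-split (s≤s c≤m)) ⟩
      filter U′? (upTo (suc c) ++ above)           ≡⟨ filter-++ U′? (upTo (suc c)) above ⟩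
      filter U′? (upTo (suc c)) ++ filter U′? above ≡⟨ cong₂ _++_ unchanged (filter-none U′? newly-blocked) ⟩
      filter U? (upTo (suc c)) ++ []                ≡⟨ ++-identityʳ _ ⟩
      filter U? (upTo (suc c))                      ∎

label-∷ʳ-above : ∀ (e : Vec ℕ n) {t} → InA e → t < n ∸ maxSeq e →
                 label (e ∷ʳ (suc (maxSeq e) + t))
                   ≡ (unblockedBelow e (suc (maxSeq e)) + suc t , n ∸ maxSeq e ∸ t)
label-∷ʳ-above {n} e {t} ia t< = begin
  label (e ∷ʳ c)
    ≡⟨ label-≡ (e ∷ʳ c) (InA-∷ʳ⁺ e c ia (s≤s (<∸⇒+< m≤n t<)) (maxSeq<⇒unblocked e m<c)) ⟩
  (unblockedBelow (e ∷ʳ c) (suc (maxSeq (e ∷ʳ c))) , suc n ∸ maxSeq (e ∷ʳ c))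
    ≡⟨ cong (λ m′ → unblockedBelow (e ∷ʳ c) (suc m′) , suc n ∸ m′) max-new ⟩
  (unblockedBelow (e ∷ʳ c) (suc c) , n ∸ (m + t))
    ≡⟨ cong₂ _,_ unblocked-∷ʳ (sym (∸-+-assoc n m t)) ⟩
  (unblockedBelow e (suc m) + suc t , n ∸ m ∸ t)
    ∎
  where
    open ≡-Reasoning
    m : ℕ
    m = maxSeq e
    c : ℕ
    c = suc m + t
    m≤n : m ≤ n
    m≤n = InvSeq⇒maxSeq≤ e (proj₁ ia)
    m<c : m < c
    m<c = s≤s (m≤m+n m t)
    U? : Decidable (∁ (Blocked e))
    U? = ∁? (Blocked? e)
    above : List ℕ
    above = map (suc m +_) (upTo (suc t))
    max-new : maxSeq (e ∷ʳ c) ≡ c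
    max-new = trans (maxSeq-∷ʳ e c) (m≤n⇒m⊔n≡n (<⇒≤ m<c))
    unchanged : filter (∁? (Blocked? (e ∷ʳ c))) (upTo (suc c)) ≡ filter U? (upTo (suc c))
    unchanged = filter-cong-local (∁? (Blocked? (e ∷ʳ c))) U? λ _ →
      unblocked-∷ʳ⇔ e c λ (c<x , x≤m) → <⇒≱ m<c (≤-trans (<⇒≤ c<x) x≤m)
    unblocked-∷ʳ : unblockedBelow (e ∷ʳ c) (suc c) ≡ unblockedBelow e (suc m) + suc t
    unblocked-∷ʳ = begin
      length (filter (∁? (Blocked? (e ∷ʳ c))) (upTo (suc c)))
        ≡⟨ cong length unchanged ⟩
      length (filter U? (upTo (suc c)))
        ≡⟨ cong (length ∘ filter U? ∘ upTo) (sym (+-suc (suc m) t)) ⟩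
      length (filter U? (upTo (suc m + suc t)))
        ≡⟨ cong (length ∘ filter U?) (upTo-+ (suc m) (suc t)) ⟩
      length (filter U? (upTo (suc m) ++ above))
        ≡⟨ cong length (filter-++ U? (upTo (suc m)) above) ⟩
      length (filter U? (upTo (suc m)) ++ filter U? above)
        ≡⟨ cong (λ ys → length (filter U? (upTo (suc m)) ++ ys)) (filter-all U? all-unblocked) ⟩
      length (filter U? (upTo (suc m)) ++ above)
        ≡⟨ length-++ (filter U? (upTo (suc m))) ⟩
      unblockedBelow e (suc m) + length above
        ≡⟨ cong (unblockedBelow e (suc m) +_) (length-map-upTo (suc m +_) (suc t)) ⟩
      unblockedBelow e (suc m) + suc t
        ∎
      where
        all-unblocked : All (∁ (Blocked e)) above
        all-unblocked = All-map⁺ (All-upTo λ {s} _ → maxSeq<⇒unblocked e (s≤s (m≤m+n m s)))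

map-label-children-≤maxSeq : ∀ (e : Vec ℕ n) → InA e →
  map (λ c → label (e ∷ʳ c)) (filter (∁? (Blocked? e)) (upTo (suc (maxSeq e))))
    ≡ map (λ i → (suc i , suc (n ∸ maxSeq e))) (upTo (unblockedBelow e (suc (maxSeq e))))
map-label-children-≤maxSeq {n} e ia = begin
  map (λ c → label (e ∷ʳ c)) below
    ≡⟨ map-cong-local (All-filter-upTo U? λ x<sm u → label-∷ʳ-≤maxSeq e ia u (s≤s⁻¹ x<sm)) ⟩
  map (λ c → (unblockedBelow e (suc c) , suc k)) below
    ≡⟨ map-∘ below ⟩
  map (_, suc k) (map (unblockedBelow e ∘ suc) below)
    ≡⟨ cong (map (_, suc k)) (map-rank-filter-upTo U? (suc (maxSeq e))) ⟩
  map (_, suc k) (map suc (upTo (unblockedBelow e (suc (maxSeq e)))))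
    ≡⟨ map-∘ (upTo (unblockedBelow e (suc (maxSeq e)))) ⟨
  map (λ i → (suc i , suc k)) (upTo (unblockedBelow e (suc (maxSeq e))))
    ∎
  where
    open ≡-Reasoning
    k : ℕ
    k = n ∸ maxSeq e
    U? : Decidable (∁ (Blocked e))
    U? = ∁? (Blocked? e)
    below : List ℕ
    below = filter U? (upTo (suc (maxSeq e)))

map-label-children-above : ∀ (e : Vec ℕ n) → InA e →
  map (λ c → label (e ∷ʳ c)) (map (suc (maxSeq e) +_) (upTo (n ∸ maxSeq e)))
    ↭ map (λ j → (unblockedBelow e (suc (maxSeq e)) + (n ∸ maxSeq e ∸ j) , suc j)) (upTo (n ∸ maxSeq e))
map-label-children-above {n} e ia = begin
  map child (map (suc m +_) (upTo k))      ≡⟨ map-∘ (upTo k) ⟨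
  map (child ∘ (suc m +_)) (upTo k)        ≡⟨ map-cong-local (All-upTo child-above) ⟩
  map (λ t → sibling (k ∸ suc t)) (upTo k) ↭⟨ map-upTo-reverse-↭ sibling k ⟩
  map sibling (upTo k)                     ∎
  where
    open PermutationReasoning
    m : ℕ
    m = maxSeq e
    k : ℕ
    k = n ∸ m
    h : ℕ
    h = unblockedBelow e (suc m)
    child : ℕ → ℕ × ℕ
    child c = label (e ∷ʳ c)
    sibling : ℕ → ℕ × ℕ
    sibling j = (h + (k ∸ j) , suc j)
    child-above : ∀ {t} → t < k → child (suc m + t) ≡ sibling (k ∸ suc t)
    child-above {t} t<k = trans (label-∷ʳ-above e ia t<k)
      (cong₂ _,_ (cong (h +_) (sym (m∸[m∸n]≡n t<k))) (+-∸-assoc 1 t<k))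

map-label-children : ∀ (e : Vec ℕ n) → InA e → map (λ c → label (e ∷ʳ c)) (activeSites e) ↭ rule (label e)
map-label-children {n} e ia = begin
  map child (activeSites e)          ≡⟨ cong (map child) (activeSites-split e ia) ⟩
  map child (below ++ above)         ≡⟨ map-++ child below above ⟩
  map child below ++ map child above ↭⟨ Perm.++⁺ (↭-reflexive (map-label-children-≤maxSeq e ia))
                                                 (map-label-children-above e ia) ⟩
  rule (unblockedBelow e (suc (maxSeq e)) , n ∸ maxSeq e)
                                     ≡⟨ cong rule (label-≡ e ia) ⟨
  rule (label e)                     ∎
  where
    open PermutationReasoning
    child : ℕ → ℕ × ℕ
    child c = label (e ∷ʳ c)
    below : List ℕ
    below = filter (∁? (Blocked? e)) (upTo (suc (maxSeq e)))
    above : List ℕ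
    above = map (suc (maxSeq e) +_) (upTo (n ∸ maxSeq e))

-- The generating tree

children : Vec ℕ n → List (Vec ℕ (suc n))
children e = map (e ∷ʳ_) (activeSites e)

generation : (n : ℕ) → List (Vec ℕ (suc n))
generation zero    = (0 ∷ []) ∷ []
generation (suc n) = concatMap children (generation n)

∈-children⁺ : ∀ (e : Vec ℕ n) {c} → InA (e ∷ʳ c) → e ∷ʳ c ∈ children e
∈-children⁺ e {c} ia =
  ∈-map⁺ (e ∷ʳ_) (∈-filter⁺ (λ x → InA? (e ∷ʳ x)) (∈-upTo⁺ (proj₁ (proj₂ (InA-∷ʳ⁻ e c ia)))) ia)

∈-children⁻ : ∀ (e : Vec ℕ n) {e′} → e′ ∈ children e → InA e′
∈-children⁻ e e′∈ with ∈-map⁻ (e ∷ʳ_) e′∈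
... | c , c∈ , refl = proj₂ (∈-filter⁻ (λ x → InA? (e ∷ʳ x)) c∈)

children-unique : ∀ (e : Vec ℕ n) → Unique (children e)
children-unique {n} e =
  Unique.map⁺ (∷ʳ-injectiveʳ e e) (Unique.filter⁺ (λ x → InA? (e ∷ʳ x)) (Unique.upTo⁺ (suc n)))

children-disjoint : ∀ {e₁ e₂ : Vec ℕ n} → e₁ ≢ e₂ → Disjoint (children e₁) (children e₂)
children-disjoint {e₁ = e₁} {e₂} e₁≢e₂ (v∈₁ , v∈₂) with ∈-map⁻ (e₁ ∷ʳ_) v∈₁ | ∈-map⁻ (e₂ ∷ʳ_) v∈₂
... | _ , _ , refl | _ , _ , eq = e₁≢e₂ (∷ʳ-injectiveˡ e₁ e₂ eq)

InA-0 : InA (0 ∷ [])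
InA-0 = toWitness {a? = InA? (0 ∷ [])} tt

generation-sound : ∀ n {e} → e ∈ generation n → InA e
generation-sound zero    (here refl) = InA-0
generation-sound (suc n) e′∈ =
  let e , _ , e′∈children = find (∈-concatMap⁻ children {xs = generation n} e′∈)
  in ∈-children⁻ e e′∈children

generation-complete : ∀ n (e : Vec ℕ (suc n)) → InA e → e ∈ generation n
generation-complete zero    (x ∷ []) (inv , _) with inv fzero
... | s≤s z≤n = here refl
generation-complete (suc n) e′       ia with initLast e′
... | e , c , refl =
  ∈-concatMap⁺ children (lose (generation-complete n e (proj₁ (InA-∷ʳ⁻ e c ia))) (∈-children⁺ e ia))

generation-unique : ∀ n → Unique (generation n)
generation-unique zero    = [] AllPairs.∷ AllPairs.[]
generation-unique (suc n) = concatMap-unique children (generation-unique n) children-unique children-disjoint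

map-label-generation : ∀ n → map label (generation n) ↭ treeLevel n
map-label-generation zero    = ↭-refl
map-label-generation (suc n) = begin
  map label (concatMap children (generation n))   ≡⟨ map-concatMap label children (generation n) ⟩
  concatMap (map label ∘ children) (generation n) ↭⟨ concatMap-cong-↭ (generation n) labels-children ⟩
  concatMap (rule ∘ label) (generation n)         ≡⟨ concatMap-map rule label (generation n) ⟨
  concatMap rule (map label (generation n))       ↭⟨ concatMap⁺ rule (map-label-generation n) ⟩
  concatMap rule (treeLevel n)                    ∎
  where
    open PermutationReasoning
    labels-children : ∀ {e} → e ∈ generation n → map label (children e) ↭ rule (label e)
    labels-children {e} e∈ = ↭-trans (↭-reflexive (sym (map-∘ (activeSites e))))
                                     (map-label-children e (generation-sound n e∈))

length-generation : ∀ n → length (generation n) ≡ SB (suc n)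
length-generation n = trans (sym (length-map label (generation n))) (Perm.↭-length (map-label-generation n))

mainTheorem15 :
    (InA (0 ∷ []) × label (0 ∷ []) ≡ (1 , 1))
    × ((n : ℕ) (e : Vec ℕ (suc n)) → InA e →
        map (λ c → label (e ∷ʳ c)) (activeSites e) ↭ rule (label e))
    × ((n : ℕ) → ∃ λ (L : List (Vec ℕ (suc n))) →
        Unique L × ((e : Vec ℕ (suc n)) → (e ∈ L) ⇔ InA e) × length L ≡ SB (suc n))
mainTheorem15 =
    (InA-0 , refl)
  , (λ n → map-label-children)
  , (λ n → generation n , generation-unique n
         , (λ e → mk⇔ (generation-sound n) (generation-complete n e)) , length-generation n)
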